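{- For all integers $p\ge1$ and $q\ge0$, the two-rooted comb of type III $T_3(p,q)$ is PE-inherent.
   Context: Graphs are simple and undirected. A two-rooted graph is a triple $(H,s,t)$ with $H$ a finite graph and $s,t\in V(H)$ not necessarily distinct. For $p,q,r\ge0$ with $p+q+r>0$, $F(p,q,r)$ is the path $(a_1,\dots,a_{p+q+r})$ together with pendant vertices $b_{p+1},\dots,b_{p+q}$, $b_{p+i}$ adjacent to $a_{p+i}$. $T_3(p,q)=(F(p,q,p+1),a_1,a_{p+q+1})$. A copy of $(\hat H,\hat s,\hat t)$ in a graph $G$ is $(H,s,t)$ with $H$ an induced subgraph of $G$ and an isomorphism $\hat H\to H$ mapping $\hat s\mapsto s$, $\hat t\mapsto t$. An extension of such a copy in $G$ is $(H',s',t')$ with $H'$ an induced subgraph of $G$, $V(H')=V(H)\cup\{s',t'\}$, $s'\ne t'$ not in $V(H)$, $H'-\{s',t'\}=H$, and $s$ (resp. $t$) the unique neighbour of $s'$ (resp. $t'$) in $H'$. A copy is simplicial if it has no extension. Given a simplicial copy $(H,s,t)$ in $G$, a pendant extension (PE) of $G$ with respect to it is any graph obtained from $G$ by adding the minimum number of pendant edges (to new vertices) at $s$ and/or $t$ so that $(H,s,t)$ becomes non-simplicial. A PE-sequence of $(\hat H,\hat s,\hat t)$ is a finite or infinite sequence $(G_i)_{i\ge0}$ with $G_0=\hat H$ where, if $G_i$ contains a simplicial copy of $(\hat H,\hat s,\hat t)$, $G_{i+1}$ is a PE of $G_i$ with respect to some simplicial copy, and otherwise the sequence ends at $G_i$.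 A two-rooted graph is PE-inherent if all of its PE-sequences are infinite. -}

module Defs where

open import Data.Nat using (ℕ; zero; suc; _+_; _∸_; _≤_; _<_; z≤n; s≤s; _≡ᵇ_; _<ᵇ_; _≤ᵇ_)
open import Data.Nat.Properties using (m≤m+n; m<m+n; ≤-trans; <-≤-trans; ≤-<-trans)
open import Data.Bool using (Bool; true; false; not; _∧_; _∨_)
open import Data.Bool.Properties using (∨-comm)
open import Data.Fin using (Fin; toℕ; fromℕ<; splitAt; _↑ˡ_; _≟_)
open import Data.List using (List; length; lookup)
open import Data.List.Relation.Unary.All using (All)
open import Data.Sum using (_⊎_; inj₁; inj₂)
open import Data.Product using (Σ; _×_; _,_)
open import Relation.Nullary using (¬_)
open import Relation.Nullary.Decidable using (⌊_⌋)
open import Relation.Binary.PropositionalEquality using (_≡_; refl; cong₂)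

record Graph : Set where
  field
    size       : ℕ
    adj        : Fin size → Fin size → Bool
    adj-sym    : ∀ i j → adj i j ≡ adj j i
    adj-irrefl : ∀ i → adj i i ≡ false
open Graph public

record TwoRooted : Set where
  field
    graph : Graph
    root₁ : Fin (size graph)
    root₂ : Fin (size graph)
open TwoRooted public

≡ᵇ-refl : ∀ n → (n ≡ᵇ n) ≡ true
≡ᵇ-refl zero    = refl
≡ᵇ-refl (suc n) = ≡ᵇ-refl n

≡ᵇ-sym : ∀ m n → (m ≡ᵇ n) ≡ (n ≡ᵇ m)
≡ᵇ-sym zero    zero    = refl
≡ᵇ-sym zero    (suc n) = refl
≡ᵇ-sym (suc m) zero    = refl
≡ᵇ-sym (suc m) (suc n) = ≡ᵇ-sym m n

symGraph : ℕ → (ℕ → ℕ → Bool) → Graph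
symGraph n R = record
  { size       = n
  ; adj        = λ i j → not (toℕ i ≡ᵇ toℕ j) ∧ (R (toℕ i) (toℕ j) ∨ R (toℕ j) (toℕ i))
  ; adj-sym    = λ i j → cong₂ (λ a b → not a ∧ b) (≡ᵇ-sym (toℕ i) (toℕ j))
                                (∨-comm (R (toℕ i) (toℕ j)) (R (toℕ j) (toℕ i)))
  ; adj-irrefl = λ i → irr i
  }
  where
  irr : ∀ (i : Fin n) → (not (toℕ i ≡ᵇ toℕ i) ∧ (R (toℕ i) (toℕ i) ∨ R (toℕ i) (toℕ i))) ≡ false
  irr i rewrite ≡ᵇ-refl (toℕ i) = refl

-- The comb F(p,q,r): path a_1 … a_{p+q+r} with pendant vertices
-- b_{p+1} … b_{p+q}, b_{p+i} adjacent to a_{p+i}.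
-- Labelling: a_i ↦ i - 1 (for 1 ≤ i ≤ m, m = p+q+r),
--            b_{p+j} ↦ m + (j - 1) (for 1 ≤ j ≤ q).

combSize : ℕ → ℕ → ℕ → ℕ
combSize p q r = p + q + r + q

combRel : ℕ → ℕ → ℕ → ℕ → ℕ → Bool
combRel p q r x y =
  ((suc x ≡ᵇ y) ∧ (y <ᵇ m))                                -- path edge a_{x+1} a_{x+2}
  ∨ ((x <ᵇ m) ∧ (m ≤ᵇ y) ∧ (x ≡ᵇ (p + (y ∸ m))))         -- pendant edge a_{p+j} b_{p+j}
  where m = p + q + r

F : ℕ → ℕ → ℕ → Graph
F p q r = symGraph (combSize p q r) (combRel p q r)

-- roots of T₃(p,q): a_1 (label 0) and a_{p+q+1} (label p+q)
T₃-lt₂ : ∀ p q → p + q < combSize p q (suc p)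
T₃-lt₂ p q = <-≤-trans (m<m+n (p + q) (s≤s z≤n)) (m≤m+n (p + q + suc p) q)

T₃-lt₁ : ∀ p q → 0 < combSize p q (suc p)
T₃-lt₁ p q = ≤-<-trans z≤n (T₃-lt₂ p q)

T₃ : ℕ → ℕ → TwoRooted
T₃ p q = record
  { graph = F p q (suc p)
  ; root₁ = fromℕ< (T₃-lt₁ p q)
  ; root₂ = fromℕ< (T₃-lt₂ p q)
  }

record Copy (R : TwoRooted) (G : Graph) : Set where
  field
    emb     : Fin (size (graph R)) → Fin (size G)
    emb-inj : ∀ i j → emb i ≡ emb j → i ≡ j
    emb-adj : ∀ i j → adj (graph R) i j ≡ adj G (emb i) (emb j)
open Copy public

record Extension (G : Graph) {h : ℕ} (f : Fin h → Fin (size G))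
                 (s t : Fin (size G)) : Set where
  field
    s′ t′    : Fin (size G)
    s′≢t′    : ¬ (s′ ≡ t′)
    s′∉H     : ∀ i → ¬ (f i ≡ s′)
    t′∉H     : ∀ i → ¬ (f i ≡ t′)
    s′~s     : adj G s′ s ≡ true
    t′~t     : adj G t′ t ≡ true
    s′≁t′    : adj G s′ t′ ≡ false
    s′-uniq  : ∀ i → adj G s′ (f i) ≡ true → f i ≡ s
    t′-uniq  : ∀ i → adj G t′ (f i) ≡ true → f i ≡ t

HasExtension : ∀ {R G} → Copy R G → Set
HasExtension {R} {G} c = Extension G (emb c) (emb c (root₁ R)) (emb c (root₂ R))

Simplicial : ∀ {R G} → Copy R G → Set
Simplicial c = ¬ HasExtension c

pendAdj : (G : Graph) (l : List (Fin (size G))) →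
          Fin (size G) ⊎ Fin (length l) → Fin (size G) ⊎ Fin (length l) → Bool
pendAdj G l (inj₁ a) (inj₁ b) = adj G a b
pendAdj G l (inj₁ a) (inj₂ m) = ⌊ a ≟ lookup l m ⌋
pendAdj G l (inj₂ m) (inj₁ a) = ⌊ a ≟ lookup l m ⌋
pendAdj G l (inj₂ m) (inj₂ k) = false

pendAdj-sym : ∀ G l x y → pendAdj G l x y ≡ pendAdj G l y x
pendAdj-sym G l (inj₁ a) (inj₁ b) = adj-sym G a b
pendAdj-sym G l (inj₁ a) (inj₂ m) = refl
pendAdj-sym G l (inj₂ m) (inj₁ a) = refl
pendAdj-sym G l (inj₂ m) (inj₂ k) = refl

pendAdj-irr : ∀ G l x → pendAdj G l x x ≡ false
pendAdj-irr G l (inj₁ a) = adj-irrefl G a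
pendAdj-irr G l (inj₂ m) = refl

addPendants : (G : Graph) → List (Fin (size G)) → Graph
addPendants G l = record
  { size       = size G + length l
  ; adj        = λ i j → pendAdj G l (splitAt (size G) i) (splitAt (size G) j)
  ; adj-sym    = λ i j → pendAdj-sym G l (splitAt (size G) i) (splitAt (size G) j)
  ; adj-irrefl = λ i → pendAdj-irr G l (splitAt (size G) i)
  }

AtRoots : ∀ {R G} → Copy R G → List (Fin (size G)) → Set
AtRoots {R} c l = All (λ v → (v ≡ emb c (root₁ R)) ⊎ (v ≡ emb c (root₂ R))) l

MakesNonSimplicial : ∀ {R G} → Copy R G → List (Fin (size G)) → Set
MakesNonSimplicial {R} {G} c l =
  Extension (addPendants G l) (λ i → emb c i ↑ˡ length l)
            (emb c (root₁ R) ↑ˡ length l)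
            (emb c (root₂ R) ↑ˡ length l)

PendantChoice : ∀ {R G} → Copy R G → List (Fin (size G)) → Set
PendantChoice c l =
  AtRoots c l × MakesNonSimplicial c l ×
  (∀ l′ → AtRoots c l′ → MakesNonSimplicial c l′ → length l ≤ length l′)

data FinitePESeqFrom (R : TwoRooted) : Graph → Set where
  stop : ∀ {G} → ¬ (Σ (Copy R G) Simplicial) → FinitePESeqFrom R G
  step : ∀ {G} (c : Copy R G) → Simplicial c →
         (l : List (Fin (size G))) → PendantChoice c l →
         FinitePESeqFrom R (addPendants G l) → FinitePESeqFrom R G

-- PE-inherent: every PE-sequence (starting at G₀ = Ĥ) is infinite,
-- i.e. there is no finite PE-sequence.
PEInherent : TwoRooted → Set
PEInherent R = ¬ FinitePESeqFrom R (graph R)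

-- Copies of T₃(p,q) are handled as induced embeddings of a window of the
-- one-way infinite comb. Adding pendant vertices keeps the original copy and
-- keeps every vertex with at most one neighbour of smaller index, so each graph
-- of a PE-sequence is a forest containing a copy. If the sequence stopped at G,
-- every copy in G would have an extension (s′, t′). Reflecting a copy about the
-- end of its spine and attaching t′ as the new tooth, then reflecting again and
-- attaching the s′ of the new copy as the new end of the spine, gives a copy whose
-- spine is the old one moved one vertex further. Iterating yields an endless
-- non-backtracking walk in the finite forest G, which is impossible.

module Submission where

open import Data.Bool using (Bool; true; false; not; T)
open import Data.Bool.Properties using (T-≡; T-∧; T-∨; ⇔→≡)
open import Data.Empty using (⊥; ⊥-elim)
open import Data.Fin as Fin using (Fin; toℕ; fromℕ<; _↑ˡ_; _↑ʳ_; splitAt)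
import Data.Fin.Properties as Fin
open import Data.List using (List; length; lookup)
open import Data.Nat
  using (ℕ; zero; suc; _+_; _∸_; _≤_; _<_; z≤n; s≤s; _≡ᵇ_; _<ᵇ_; _≤ᵇ_; _<?_; _≟_)
open import Data.Nat.Induction using (<-wellFounded)
open import Data.Nat.Properties
open import Data.Product using (Σ; ∃-syntax; _×_; _,_; proj₁; proj₂)
open import Data.Product.Function.NonDependent.Propositional using (_×-⇔_)
open import Data.Sum using (_⊎_; inj₁; inj₂; [_,_]; swap)
open import Data.Sum.Function.Propositional using (_⊎-⇔_)
open import Function using (_∘_; _$_)
open import Function.Bundles using (_⇔_; mk⇔; Equivalence)
import Function.Properties.Equivalence as ⇔
open import Induction.WellFounded using (Acc; acc)
open import Level using (0ℓ)
open import Relation.Binary.Definitions using (DecidableEquality)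
open import Relation.Binary.PropositionalEquality
  using (_≡_; _≢_; refl; sym; trans; cong; subst; subst₂; module ≡-Reasoning)
open import Relation.Nullary using (¬_; yes; no; contradiction)
open import Relation.Nullary.Decidable using (map′; toWitness)
open import Relation.Unary using (Pred; _∪_; _∖_; ｛_｝; _⊆_)

open import Defs

open Equivalence using (to; from)

data Comb : Set where
  spine tooth : ℕ → Comb

infix 4 _⟶_ _~_

_⟶_ : Comb → Comb → Set
spine i ⟶ spine j = suc i ≡ j
spine i ⟶ tooth j = i ≡ j
tooth _ ⟶ _       = ⊥

_~_ : Comb → Comb → Set
v ~ w = v ⟶ w ⊎ w ⟶ v

~-sym : ∀ {v w} → v ~ w → w ~ v
~-sym = swap

~-irrefl : ∀ {v} → ¬ v ~ v
~-irrefl {spine i} (inj₁ e) = 1+n≢n e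
~-irrefl {spine i} (inj₂ e) = 1+n≢n e

⟶-parent-unique : ∀ {u v w} → u ⟶ w → v ⟶ w → u ≡ v
⟶-parent-unique {spine i} {spine j} {spine _} refl e = cong spine (sym (suc-injective e))
⟶-parent-unique {spine i} {spine j} {tooth _} refl e = cong spine (sym e)

spine-injective : ∀ {i j} → spine i ≡ spine j → i ≡ j
spine-injective refl = refl

tooth-injective : ∀ {i j} → tooth i ≡ tooth j → i ≡ j
tooth-injective refl = refl

_≟ᶜ_ : DecidableEquality Comb
spine i ≟ᶜ spine j = map′ (cong spine) spine-injective (i ≟ j)
spine i ≟ᶜ tooth j = no λ ()
tooth i ≟ᶜ spine j = no λ ()
tooth i ≟ᶜ tooth j = map′ (cong tooth) tooth-injective (i ≟ j)

tooth-~ : ∀ {j w} → tooth j ~ w ⇔ spine j ≡ w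
tooth-~ {j} {spine i} = mk⇔ (λ { (inj₂ refl) → refl }) (λ { refl → inj₂ refl })
tooth-~ {j} {tooth i} = mk⇔ (λ { (inj₁ ()) ; (inj₂ ()) }) λ ()

index : Comb → ℕ
index (spine i) = i
index (tooth j) = j

reflect : ℕ → Comb → Comb
reflect c (spine i) = spine (c ∸ i)
reflect c (tooth j) = tooth (c ∸ j)

1+[c∸i]≡c∸j⇔1+j≡i : ∀ {c i j} → i ≤ c → j ≤ c → suc (c ∸ i) ≡ c ∸ j ⇔ suc j ≡ i
1+[c∸i]≡c∸j⇔1+j≡i {c} {i} {j} i≤c j≤c = mk⇔ cancel shift
  where
  open ≡-Reasoning
  cancel : suc (c ∸ i) ≡ c ∸ j → suc j ≡ i
  cancel e = sym $ +-cancelˡ-≡ (c ∸ i) i (suc j) $ begin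
    c ∸ i + i       ≡⟨ m∸n+n≡m i≤c ⟩
    c               ≡⟨ m∸n+n≡m j≤c ⟨
    c ∸ j + j       ≡⟨ cong (_+ j) e ⟨
    suc (c ∸ i) + j ≡⟨ +-suc (c ∸ i) j ⟨
    c ∸ i + suc j   ∎
  shift : suc j ≡ i → suc (c ∸ i) ≡ c ∸ j
  shift refl = sym (+-∸-assoc 1 i≤c)

reflect-injective : ∀ c {v w} → index v ≤ c → index w ≤ c → reflect c v ≡ reflect c w → v ≡ w
reflect-injective c {spine i} {spine j} i≤c j≤c =
  cong spine ∘ ∸-cancelˡ-≡ i≤c j≤c ∘ spine-injective
reflect-injective c {tooth i} {tooth j} i≤c j≤c =
  cong tooth ∘ ∸-cancelˡ-≡ i≤c j≤c ∘ tooth-injective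

c∸i≡c∸j⇔i≡j : ∀ {c i j} → i ≤ c → j ≤ c → c ∸ i ≡ c ∸ j ⇔ i ≡ j
c∸i≡c∸j⇔i≡j i≤c j≤c = mk⇔ (∸-cancelˡ-≡ i≤c j≤c) (cong (_ ∸_))

⊎-swap-⇔ : ∀ {A B : Set} → (A ⊎ B) ⇔ (B ⊎ A)
⊎-swap-⇔ = mk⇔ swap swap

reflect-~ : ∀ c {v w} → index v ≤ c → index w ≤ c → reflect c v ~ reflect c w ⇔ v ~ w
reflect-~ c {spine i} {spine j} i≤c j≤c =
  ⇔.trans (1+[c∸i]≡c∸j⇔1+j≡i i≤c j≤c ⊎-⇔ 1+[c∸i]≡c∸j⇔1+j≡i j≤c i≤c) ⊎-swap-⇔
reflect-~ c {spine i} {tooth j} i≤c j≤c = c∸i≡c∸j⇔i≡j i≤c j≤c ⊎-⇔ ⇔.refl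
reflect-~ c {tooth j} {spine i} j≤c i≤c = ⇔.refl ⊎-⇔ c∸i≡c∸j⇔i≡j i≤c j≤c
reflect-~ c {tooth i} {tooth j} i≤c j≤c = ⇔.refl

update : ∀ {A : Set} → (Comb → A) → Comb → A → Comb → A
update π u z v with u ≟ᶜ v
... | yes _ = z
... | no  _ = π v

update-same : ∀ {A : Set} (π : Comb → A) u z → update π u z u ≡ z
update-same π u z with u ≟ᶜ u
... | yes _  = refl
... | no u≢u = ⊥-elim (u≢u refl)

update-other : ∀ {A : Set} (π : Comb → A) u z {v} → u ≢ v → update π u z v ≡ π v
update-other π u z {v} u≢v with u ≟ᶜ v
... | yes u≡v = ⊥-elim (u≢v u≡v)
... | no  _   = refl

record Induced (G : Graph) (S : Pred Comb 0ℓ) (π : Comb → Fin (size G)) : Set where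
  field
    injective : ∀ {v w} → S v → S w → π v ≡ π w → v ≡ w
    adjacent  : ∀ {v w} → S v → S w → adj G (π v) (π w) ≡ true ⇔ v ~ w
open Induced

record Relabelling (S′ S : Pred Comb 0ℓ) (σ : Comb → Comb) : Set where
  field
    into      : ∀ {v} → S′ v → S (σ v)
    injective : ∀ {v w} → S′ v → S′ w → σ v ≡ σ w → v ≡ w
    adjacent  : ∀ {v w} → S′ v → S′ w → σ v ~ σ w ⇔ v ~ w

reflect-relabelling : ∀ {S′ S} c → (∀ {v} → S′ v → index v ≤ c) →
                      (∀ {v} → S′ v → S (reflect c v)) → Relabelling S′ S (reflect c)
reflect-relabelling c bounded into = record
  { into      = into
  ; injective = λ sv sw → reflect-injective c (bounded sv) (bounded sw)
  ; adjacent  = λ sv sw → reflect-~ c (bounded sv) (bounded sw)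
  }

record Pendant (G : Graph) (S : Pred Comb 0ℓ) (π : Comb → Fin (size G))
               (r : Comb) (z : Fin (size G)) : Set where
  field
    fresh    : ∀ {w} → S w → π w ≢ z
    attached : adj G z (π r) ≡ true
    unique   : ∀ {w} → S w → adj G z (π w) ≡ true → r ≡ w
open Pendant

module _ {G : Graph} where

  Induced-∘ : ∀ {S′ S π σ} → Induced G S π → Relabelling S′ S σ → Induced G S′ (π ∘ σ)
  Induced-∘ g σ = record
    { injective = λ sv sw → R.injective sv sw ∘ injective g (R.into sv) (R.into sw)
    ; adjacent  = λ sv sw → ⇔.trans (adjacent g (R.into sv) (R.into sw)) (R.adjacent sv sw)
    }
    where module R = Relabelling σ

  Induced-⊆ : ∀ {S′ S π} → S′ ⊆ S → Induced G S π → Induced G S′ π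
  Induced-⊆ S′⊆S g = record
    { injective = λ sv sw → injective g (S′⊆S sv) (S′⊆S sw)
    ; adjacent  = λ sv sw → adjacent g (S′⊆S sv) (S′⊆S sw)
    }

  Pendant-∘ : ∀ {S′ S π σ r r′ z} → Relabelling S′ S σ → S′ r′ → σ r′ ≡ r →
              Pendant G S π r z → Pendant G S′ (π ∘ σ) r′ z
  Pendant-∘ σ-rel sr′ refl P = record
    { fresh    = fresh P ∘ R.into
    ; attached = attached P
    ; unique   = λ sw a → R.injective sr′ sw (unique P (R.into sw) a)
    }
    where module R = Relabelling σ-rel

  Induced-insert : ∀ {S π r z u} → Induced G S π → Pendant G S π r z → ¬ S u →
                   (∀ {w} → S w → u ~ w ⇔ r ≡ w) → Induced G (S ∪ ｛ u ｝) (update π u z)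
  Induced-insert {S} {π} {r} {z} {u} g P u∉S neighbours = record
    { injective = injective′
    ; adjacent  = adjacent′
    }
    where
    π′ = update π u z

    old : ∀ {v} → S v → π′ v ≡ π v
    old sv = update-other π u z λ { refl → u∉S sv }

    z-adjacent : ∀ {w} → S w → adj G z (π w) ≡ true ⇔ u ~ w
    z-adjacent sw = mk⇔ (from (neighbours sw) ∘ unique P sw)
      (λ u~w → subst (λ x → adj G z (π x) ≡ true) (to (neighbours sw) u~w) (attached P))

    injective′ : ∀ {v w} → (S ∪ ｛ u ｝) v → (S ∪ ｛ u ｝) w → π′ v ≡ π′ w → v ≡ w
    injective′ (inj₁ sv) (inj₁ sw) e  = injective g sv sw (trans (sym (old sv)) (trans e (old sw)))
    injective′ (inj₁ sv) (inj₂ refl) e =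
      ⊥-elim (fresh P sv (trans (sym (old sv)) (trans e (update-same π u z))))
    injective′ (inj₂ refl) (inj₁ sw) e =
      ⊥-elim (fresh P sw (trans (sym (old sw)) (trans (sym e) (update-same π u z))))
    injective′ (inj₂ refl) (inj₂ refl) _ = refl

    adjacent′ : ∀ {v w} → (S ∪ ｛ u ｝) v → (S ∪ ｛ u ｝) w →
                adj G (π′ v) (π′ w) ≡ true ⇔ v ~ w
    adjacent′ (inj₁ sv) (inj₁ sw) rewrite old sv | old sw = adjacent g sv sw
    adjacent′ {v} (inj₁ sv) (inj₂ refl) rewrite old sv | update-same π u z | adj-sym G (π v) z =
      ⇔.trans (z-adjacent sv) (mk⇔ ~-sym ~-sym)
    adjacent′ (inj₂ refl) (inj₁ sw) rewrite old sw | update-same π u z = z-adjacent sw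
    adjacent′ (inj₂ refl) (inj₂ refl) rewrite update-same π u z | adj-irrefl G z =
      mk⇔ (λ ()) (⊥-elim ∘ ~-irrefl)

  Induced-reattach : ∀ {S π σ r r′ z u} → Induced G S π → Pendant G S π r z →
                     Relabelling (S ∖ ｛ u ｝) S σ → (S ∖ ｛ u ｝) r′ → σ r′ ≡ r →
                     (∀ {w} → (S ∖ ｛ u ｝) w → u ~ w ⇔ r′ ≡ w) →
                     Induced G S (update (π ∘ σ) u z)
  Induced-reattach {u = u} g P σ sr′ σr′≡r neighbours = Induced-⊆ ⊆-∖-∪ $
    Induced-insert (Induced-∘ g σ) (Pendant-∘ σ sr′ σr′≡r P) (λ (_ , u≢u) → u≢u refl) neighbours
    where
    ⊆-∖-∪ : _ ⊆ (_ ∖ ｛ u ｝) ∪ ｛ u ｝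
    ⊆-∖-∪ {v} sv with u ≟ᶜ v
    ... | yes u≡v = inj₂ u≡v
    ... | no  u≢v = inj₁ (sv , u≢v)

UniqueLowerNeighbour : Graph → Set
UniqueLowerNeighbour G = ∀ {v u w} → adj G v u ≡ true → adj G v w ≡ true →
                         toℕ u < toℕ v → toℕ w < toℕ v → u ≡ w

module _ (G : Graph) (l : List (Fin (size G))) where
  private
    n = size G
    k = length l
    G⁺ = addPendants G l

  data PendantView : Fin (n + k) → Set where
    old : (a : Fin n) → PendantView (a ↑ˡ k)
    new : (b : Fin k) → PendantView (n ↑ʳ b)

  pendantView : ∀ i → PendantView i
  pendantView i with splitAt n i in eq
  ... | inj₁ a = subst PendantView (Fin.splitAt⁻¹-↑ˡ eq) (old a)
  ... | inj₂ b = subst PendantView (Fin.splitAt⁻¹-↑ʳ eq) (new b)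

  adj-old-old : ∀ a b → adj G⁺ (a ↑ˡ k) (b ↑ˡ k) ≡ adj G a b
  adj-old-old a b rewrite Fin.splitAt-↑ˡ n a k | Fin.splitAt-↑ˡ n b k = refl

  adj-new-old : ∀ b a → adj G⁺ (n ↑ʳ b) (a ↑ˡ k) ≡ true → a ≡ lookup l b
  adj-new-old b a e rewrite Fin.splitAt-↑ʳ n k b | Fin.splitAt-↑ˡ n a k = toWitness (from T-≡ e)

  adj-new-new : ∀ b c → adj G⁺ (n ↑ʳ b) (n ↑ʳ c) ≡ false
  adj-new-new b c rewrite Fin.splitAt-↑ʳ n k b | Fin.splitAt-↑ʳ n k c = refl

  new≮old : ∀ (a : Fin n) (b : Fin k) → ¬ toℕ (n ↑ʳ b) < toℕ (a ↑ˡ k)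
  new≮old a b lt rewrite Fin.toℕ-↑ʳ n b | Fin.toℕ-↑ˡ a k =
    <-irrefl refl (<-≤-trans (Fin.toℕ<n a) (≤-trans (m≤m+n n (toℕ b)) (<⇒≤ lt)))

  Induced-↑ˡ : ∀ {S π} → Induced G S π → Induced G⁺ S (λ v → π v ↑ˡ k)
  Induced-↑ˡ {π = π} g = record
    { injective = λ sv sw → injective g sv sw ∘ Fin.↑ˡ-injective k _ _
    ; adjacent  = λ {v} {w} sv sw → subst (λ b → b ≡ true ⇔ v ~ w) (sym (adj-old-old (π v) (π w)))
                                          (adjacent g sv sw)
    }

  UniqueLowerNeighbour-addPendants : UniqueLowerNeighbour G → UniqueLowerNeighbour G⁺
  UniqueLowerNeighbour-addPendants unique {v} {u} {w} vu vw u<v w<v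
    with pendantView v | pendantView u | pendantView w
  ... | old a | old b | old c = cong (_↑ˡ k) $ unique
        (trans (sym (adj-old-old a b)) vu) (trans (sym (adj-old-old a c)) vw)
        (subst₂ _<_ (Fin.toℕ-↑ˡ b k) (Fin.toℕ-↑ˡ a k) u<v)
        (subst₂ _<_ (Fin.toℕ-↑ˡ c k) (Fin.toℕ-↑ˡ a k) w<v)
  ... | old a | new b | _     = ⊥-elim (new≮old a b u<v)
  ... | old a | _     | new c = ⊥-elim (new≮old a c w<v)
  ... | new a | old b | old c = cong (_↑ˡ k) (trans (adj-new-old a b vu) (sym (adj-new-old a c vw)))
  ... | new a | new b | _     = contradiction (trans (sym vu) (adj-new-new a b)) λ ()
  ... | new a | _     | new c = contradiction (trans (sym vw) (adj-new-new a c)) λ ()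

module _ (G : Graph) (unique : UniqueLowerNeighbour G) where
  private
    n = size G

  adjacent⇒≢ : ∀ {x y} → adj G x y ≡ true → x ≢ y
  adjacent⇒≢ {x} xy refl = contradiction (trans (sym xy) (adj-irrefl G x)) λ ()

  -- A non-backtracking walk that has stepped up never steps down again, as a
  -- vertex has only one lower neighbour; so this rank of its edges decreases.
  rank : Fin n → Fin n → ℕ
  rank x y with toℕ x <? toℕ y
  ... | yes _ = n ∸ toℕ y
  ... | no  _ = n + toℕ y

  rank-decreasing : ∀ {x y z} → adj G y x ≡ true → adj G y z ≡ true → x ≢ z →
                    rank y z < rank x y
  rank-decreasing {x} {y} {z} yx yz x≢z with toℕ x <? toℕ y | toℕ y <? toℕ z
  ... | yes _   | yes y<z = ∸-monoʳ-< y<z (<⇒≤ (Fin.toℕ<n z))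
  ... | yes x<y | no  y≮z = contradiction (unique yx yz x<y z<y) x≢z
    where
    z<y : toℕ z < toℕ y
    z<y = ≤∧≢⇒< (≮⇒≥ y≮z) (adjacent⇒≢ yz ∘ sym ∘ Fin.toℕ-injective)
  ... | no  _   | yes y<z =
    <-≤-trans (∸-monoʳ-< (≤-<-trans z≤n y<z) (<⇒≤ (Fin.toℕ<n z))) (m≤m+n n (toℕ y))
  ... | no  _   | no  y≮z =
    +-monoʳ-< n (≤∧≢⇒< (≮⇒≥ y≮z) (adjacent⇒≢ yz ∘ sym ∘ Fin.toℕ-injective))

  no-endless-walk : (W : Fin n → Fin n → Set) → (∀ {x y} → W x y → adj G x y ≡ true) →
                    (∀ {x y} → W x y → ¬ ¬ (∃[ z ] W y z × x ≢ z)) → ∀ {x y} → ¬ W x y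
  no-endless-walk W W⇒adj continues = walk (<-wellFounded _)
    where
    walk : ∀ {x y} → Acc _<_ (rank x y) → ¬ W x y
    walk {x} {y} (acc smaller) xy = continues xy λ (z , yz , x≢z) →
      walk (smaller (rank-decreasing (trans (adj-sym G y x) (W⇒adj xy)) (W⇒adj yz) x≢z)) yz

≢⇒not-≡ᵇ : ∀ {x y} → x ≢ y → T (not (x ≡ᵇ y))
≢⇒not-≡ᵇ {zero}  {zero}  x≢y = x≢y refl
≢⇒not-≡ᵇ {zero}  {suc _} _   = _
≢⇒not-≡ᵇ {suc _} {zero}  _   = _
≢⇒not-≡ᵇ {suc x} {suc y} x≢y = ≢⇒not-≡ᵇ (x≢y ∘ cong suc)

module _ {n : ℕ} {R : ℕ → ℕ → Bool} (increasing : ∀ {x y} → T (R x y) → x < y) where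
  private
    G = symGraph n R

  symGraph-adj : ∀ {i j} → adj G i j ≡ true ⇔ (T (R (toℕ i) (toℕ j)) ⊎ T (R (toℕ j) (toℕ i)))
  symGraph-adj {i} {j} = mk⇔ (to T-∨ ∘ proj₂ ∘ to T-∧ ∘ from T-≡)
    (λ r → to T-≡ (from T-∧ (≢⇒not-≡ᵇ (distinct r) , from T-∨ r)))
    where
    distinct : T (R (toℕ i) (toℕ j)) ⊎ T (R (toℕ j) (toℕ i)) → toℕ i ≢ toℕ j
    distinct (inj₁ r) i≡j = <-irrefl i≡j (increasing r)
    distinct (inj₂ r) i≡j = <-irrefl (sym i≡j) (increasing r)

  symGraph-uniqueLowerNeighbour : (∀ {x y z} → T (R x z) → T (R y z) → x ≡ y) →
                                  UniqueLowerNeighbour G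
  symGraph-uniqueLowerNeighbour one-parent {v} {u} {w} vu vw u<v w<v =
    Fin.toℕ-injective (one-parent (lower vu u<v) (lower vw w<v))
    where
    lower : ∀ {x} → adj G v x ≡ true → toℕ x < toℕ v → T (R (toℕ x) (toℕ v))
    lower vx x<v with to symGraph-adj vx
    ... | inj₁ r = contradiction (increasing r) (<-asym x<v)
    ... | inj₂ r = r

module T₃-Comb (p₀ q : ℕ) where

  -- m spine vertices, of which e₀ < e₁ < e₂ are the last three
  p m N e₀ e₁ e₂ : ℕ
  p  = suc p₀
  m  = p + q + suc p
  N  = combSize p q (suc p)
  e₀ = p₀ + q + p₀
  e₁ = suc e₀
  e₂ = suc e₁

  e₁≡ : e₁ ≡ p₀ + q + p
  e₁≡ = sym (+-suc (p₀ + q) p₀)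

  e₂≡ : e₂ ≡ p + q + p
  e₂≡ = cong suc e₁≡

  m≡ : m ≡ suc e₂
  m≡ = cong suc (trans (+-suc (p₀ + q) p) (cong suc (sym e₁≡)))

  <m⇒≤e₂ : ∀ {i} → i < m → i ≤ e₂
  <m⇒≤e₂ {i} i<m = <⇒≤pred (subst (i <_) m≡ i<m)

  e₂<m : e₂ < m
  e₂<m = subst (e₂ <_) (sym m≡) (n<1+n e₂)

  e₁<m : e₁ < m
  e₁<m = <-trans (n<1+n e₁) e₂<m

  e₀<e₂ : e₀ < e₂
  e₀<e₂ = <-trans (n<1+n e₀) (n<1+n e₁)

  e₀<m : e₀ < m
  e₀<m = <-trans e₀<e₂ e₂<m

  p+q≤e₁ : p + q ≤ e₁
  p+q≤e₁ = m≤m+n (p + q) p₀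

  0<m : 0 < m
  0<m = s≤s z≤n

  p+q<m : p + q < m
  p+q<m = m<m+n (p + q) (s≤s z≤n)

  Window : Pred Comb 0ℓ
  Window (spine i) = i < m
  Window (tooth j) = p ≤ j × j < p + q

  -- Vertex x of F(p,q,p+1) is spine x for x < m and tooth (p + k) for x = m + k,
  -- so T₃(p,q) is the Window with roots spine 0 and spine (p + q).
  vertexAt : ℕ → Comb
  vertexAt x with x <? m
  ... | yes _ = spine x
  ... | no  _ = tooth (p + (x ∸ m))

  vertexAt-spine : ∀ {x} → x < m → vertexAt x ≡ spine x
  vertexAt-spine {x} x<m with x <? m
  ... | yes _   = refl
  ... | no  x≮m = contradiction x<m x≮m

  vertexAt-injective : ∀ {x y} → vertexAt x ≡ vertexAt y → x ≡ y
  vertexAt-injective {x} {y} e with x <? m | y <? m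
  ... | yes _   | yes _   = spine-injective e
  ... | no  x≮m | no  y≮m =
    ∸-cancelʳ-≡ (≮⇒≥ x≮m) (≮⇒≥ y≮m) (+-cancelˡ-≡ p _ _ (tooth-injective e))

  vertexAt-window : ∀ {x} → x < N → Window (vertexAt x)
  vertexAt-window {x} x<N with x <? m
  ... | yes x<m = x<m
  ... | no  x≮m =
    m≤m+n p _ , +-monoʳ-< p (subst (x ∸ m <_) (m+n∸m≡n m q) (∸-monoˡ-< x<N (≮⇒≥ x≮m)))

  labelOf : Comb → ℕ
  labelOf (spine i) = i
  labelOf (tooth j) = m + (j ∸ p)

  labelOf-< : ∀ {v} → Window v → labelOf v < N
  labelOf-< {spine i} i<m        = <-≤-trans i<m (m≤m+n m q)
  labelOf-< {tooth j} (p≤j , j<) = +-monoʳ-< m (subst (j ∸ p <_) (m+n∸m≡n p q) (∸-monoˡ-< j< p≤j))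

  vertexAt-labelOf : ∀ {v} → Window v → vertexAt (labelOf v) ≡ v
  vertexAt-labelOf {spine i} i<m       = vertexAt-spine i<m
  vertexAt-labelOf {tooth j} (p≤j , _) with m + (j ∸ p) <? m
  ... | yes lt = contradiction lt (m+n≮m m (j ∸ p))
  ... | no  _  = cong tooth (trans (cong (p +_) (m+n∸m≡n m (j ∸ p))) (m+[n∸m]≡n p≤j))

  R : ℕ → ℕ → Bool
  R = combRel p q (suc p)

  R⇔ : ∀ {x y} → T (R x y) ⇔ (suc x ≡ y × y < m ⊎ x < m × m ≤ y × x ≡ p + (y ∸ m))
  R⇔ = ⇔.trans T-∨ $
    ⇔.trans T-∧ (≡ᵇ⇔ ×-⇔ <ᵇ⇔) ⊎-⇔ ⇔.trans T-∧ (<ᵇ⇔ ×-⇔ ⇔.trans T-∧ (≤ᵇ⇔ ×-⇔ ≡ᵇ⇔))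
    where
    ≡ᵇ⇔ : ∀ {a b} → T (a ≡ᵇ b) ⇔ a ≡ b
    ≡ᵇ⇔ = mk⇔ (≡ᵇ⇒≡ _ _) (≡⇒≡ᵇ _ _)
    <ᵇ⇔ : ∀ {a b} → T (a <ᵇ b) ⇔ a < b
    <ᵇ⇔ = mk⇔ (<ᵇ⇒< _ _) <⇒<ᵇ
    ≤ᵇ⇔ : ∀ {a b} → T (a ≤ᵇ b) ⇔ a ≤ b
    ≤ᵇ⇔ = mk⇔ (≤ᵇ⇒≤ _ _) ≤⇒≤ᵇ

  R-increasing : ∀ {x y} → T (R x y) → x < y
  R-increasing {x} {y} r with to (R⇔ {x} {y}) r
  ... | inj₁ (refl , _)       = n<1+n x
  ... | inj₂ (x<m , m≤y , _) = <-≤-trans x<m m≤y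

  R-spec⇔⟶ : ∀ {x y} → (suc x ≡ y × y < m ⊎ x < m × m ≤ y × x ≡ p + (y ∸ m)) ⇔
                        vertexAt x ⟶ vertexAt y
  R-spec⇔⟶ {x} {y} with x <? m | y <? m
  ... | yes x<m | yes y<m =
    mk⇔ [ proj₁ , (λ (_ , m≤y , _) → contradiction y<m (≤⇒≯ m≤y)) ] (λ e → inj₁ (e , y<m))
  ... | yes x<m | no  y≮m =
    mk⇔ [ (λ (_ , y<m) → contradiction y<m y≮m) , proj₂ ∘ proj₂ ]
        (λ e → inj₂ (x<m , ≮⇒≥ y≮m , e))
  ... | no  x≮m | _       =
    mk⇔ [ (λ (e , y<m) → x≮m (<-trans (n<1+n x) (subst (_< m) (sym e) y<m))) , x≮m ∘ proj₁ ] λ ()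

  R⇔⟶ : ∀ {x y} → T (R x y) ⇔ vertexAt x ⟶ vertexAt y
  R⇔⟶ = ⇔.trans R⇔ R-spec⇔⟶

  G₀ : Graph
  G₀ = graph (T₃ p q)

  adj-T₃ : ∀ {i j} → adj G₀ i j ≡ true ⇔ vertexAt (toℕ i) ~ vertexAt (toℕ j)
  adj-T₃ {i} {j} = ⇔.trans (symGraph-adj R-increasing {i} {j}) (R⇔⟶ ⊎-⇔ R⇔⟶)

  T₃-uniqueLowerNeighbour : UniqueLowerNeighbour G₀
  T₃-uniqueLowerNeighbour = symGraph-uniqueLowerNeighbour R-increasing λ {x} {y} {z} xz yz →
    vertexAt-injective (⟶-parent-unique (to (R⇔⟶ {x} {z}) xz) (to (R⇔⟶ {y} {z}) yz))

  π₀ : Comb → Fin N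
  π₀ v with labelOf v <? N
  ... | yes v<N = fromℕ< v<N
  ... | no  _   = Fin.zero

  vertexAt-π₀ : ∀ {v} → Window v → vertexAt (toℕ (π₀ v)) ≡ v
  vertexAt-π₀ {v} wv with labelOf v <? N
  ... | yes v<N = trans (cong vertexAt (Fin.toℕ-fromℕ< v<N)) (vertexAt-labelOf wv)
  ... | no  v≮N = contradiction (labelOf-< wv) v≮N

  π₀-induced : Induced G₀ Window π₀
  π₀-induced = record
    { injective = λ sv sw e →
        trans (sym (vertexAt-π₀ sv)) (trans (cong (vertexAt ∘ toℕ) e) (vertexAt-π₀ sw))
    ; adjacent  = λ {v} {w} sv sw → subst₂ (λ x y → adj G₀ (π₀ v) (π₀ w) ≡ true ⇔ x ~ y)
                                           (vertexAt-π₀ sv) (vertexAt-π₀ sw) adj-T₃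
    }

  module _ {G : Graph} {π : Comb → Fin (size G)} (g : Induced G Window π) where

    T₃-copy : Copy (T₃ p q) G
    T₃-copy = record
      { emb     = π ∘ vertexAt ∘ toℕ
      ; emb-inj = λ i j → Fin.toℕ-injective ∘ vertexAt-injective ∘ injective g (window i) (window j)
      ; emb-adj = λ i j → ⇔→≡ (⇔.trans adj-T₃ (⇔.sym (adjacent g (window i) (window j))))
      }
      where
      window : (i : Fin N) → Window (vertexAt (toℕ i))
      window i = vertexAt-window (Fin.toℕ<n i)

    private
      c = T₃-copy

      emb-π₀ : ∀ {w} → Window w → emb c (π₀ w) ≡ π w
      emb-π₀ = cong π ∘ vertexAt-π₀

      extension-pendant : ∀ {r z} ρ → Window r → emb c ρ ≡ π r → (∀ i → ¬ emb c i ≡ z) →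
                          adj G z (emb c ρ) ≡ true →
                          (∀ i → adj G z (emb c i) ≡ true → emb c i ≡ emb c ρ) →
                          Pendant G Window π r z
      extension-pendant {r} {z} ρ wr ρ↦r z∉c z~ρ z-unique = record
        { fresh    = λ {w} ww → subst (_≢ z) (emb-π₀ ww) (z∉c (π₀ w))
        ; attached = subst (λ x → adj G z x ≡ true) ρ↦r z~ρ
        ; unique   = λ {w} ww z~w → injective g wr ww $ begin
            π r           ≡⟨ ρ↦r ⟨
            emb c ρ       ≡⟨ z-unique (π₀ w) (subst (λ x → adj G z x ≡ true) (sym (emb-π₀ ww)) z~w) ⟨
            emb c (π₀ w) ≡⟨ emb-π₀ ww ⟩
            π w           ∎
        }
        where open ≡-Reasoning

      root₁↦ : emb c (root₁ (T₃ p q)) ≡ π (spine 0)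
      root₁↦ = cong π (trans (cong vertexAt (Fin.toℕ-fromℕ< (T₃-lt₁ p q))) (vertexAt-spine 0<m))

      root₂↦ : emb c (root₂ (T₃ p q)) ≡ π (spine (p + q))
      root₂↦ = cong π (trans (cong vertexAt (Fin.toℕ-fromℕ< (T₃-lt₂ p q))) (vertexAt-spine p+q<m))

    pendant₁ : (e : HasExtension c) → Pendant G Window π (spine 0) (Extension.s′ e)
    pendant₁ e = extension-pendant (root₁ (T₃ p q)) 0<m root₁↦ s′∉H s′~s s′-uniq
      where open Extension e

    pendant₂ : (e : HasExtension c) → Pendant G Window π (spine (p + q)) (Extension.t′ e)
    pendant₂ e = extension-pendant (root₂ (T₃ p q)) p+q<m root₂↦ t′∉H t′~t t′-uniq
      where open Extension e

    reattach-tooth : ∀ {z} → Pendant G Window π (spine (p + q)) z →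
                     Induced G Window (update (π ∘ reflect e₂) (tooth p) z)
    reattach-tooth P = Induced-reattach g P (reflect-relabelling e₂ bounded into)
                                        (p<m , λ ()) (cong spine e₂∸p) (λ _ → tooth-~)
      where
      p<m : p < m
      p<m = ≤-<-trans (m≤m+n p q) p+q<m

      e₂∸p : e₂ ∸ p ≡ p + q
      e₂∸p = trans (cong (_∸ p) e₂≡) (m+n∸n≡m (p + q) p)

      e₂∸[p+q] : e₂ ∸ (p + q) ≡ p
      e₂∸[p+q] = trans (cong (_∸ (p + q)) e₂≡) (m+n∸m≡n (p + q) p)

      bounded : ∀ {v} → (Window ∖ ｛ tooth p ｝) v → index v ≤ e₂
      bounded {spine i} (i<m , _)      = <m⇒≤e₂ i<m
      bounded {tooth j} ((_ , j<) , _) = ≤-trans (<⇒≤ j<) (≤-trans p+q≤e₁ (n≤1+n e₁))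

      into : ∀ {v} → (Window ∖ ｛ tooth p ｝) v → Window (reflect e₂ v)
      into {spine i} _                      = ≤-<-trans (m∸n≤m e₂ i) e₂<m
      into {tooth j} w@((p≤j , j<) , p≢j) =
        subst (_≤ e₂ ∸ j) e₂∸[p+q] (∸-monoʳ-≤ e₂ (<⇒≤ j<)) ,
        subst (e₂ ∸ j <_) e₂∸p (∸-monoʳ-< (≤∧≢⇒< p≤j (p≢j ∘ cong tooth)) (bounded w))

    reattach-spine : ∀ {z} → Pendant G Window π (spine 0) z →
                     Induced G Window (update (π ∘ reflect e₁) (spine e₂) z)
    reattach-spine P = Induced-reattach g P (reflect-relabelling e₁ bounded into)
                                        (e₁<m , 1+n≢n ∘ spine-injective) (cong spine (n∸n≡0 e₁))
                                        neighbours
      where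
      e₁∸p₀ : e₁ ∸ p₀ ≡ p + q
      e₁∸p₀ = m+n∸n≡m (p + q) p₀

      e₁∸[p₀+q] : e₁ ∸ (p₀ + q) ≡ p
      e₁∸[p₀+q] = trans (cong (_∸ (p₀ + q)) e₁≡) (m+n∸m≡n (p₀ + q) p)

      bounded : ∀ {v} → (Window ∖ ｛ spine e₂ ｝) v → index v ≤ e₁
      bounded {spine i} (i<m , e₂≢i)   =
        <⇒≤pred (≤∧≢⇒< (<m⇒≤e₂ i<m) (e₂≢i ∘ sym ∘ cong spine))
      bounded {tooth j} ((_ , j<) , _) = ≤-trans (<⇒≤ j<) p+q≤e₁

      into : ∀ {v} → (Window ∖ ｛ spine e₂ ｝) v → Window (reflect e₁ v)
      into {spine i} _                      = ≤-<-trans (m∸n≤m e₁ i) e₁<m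
      into {tooth j} w@((p≤j , j<) , _) =
        subst (_≤ e₁ ∸ j) e₁∸[p₀+q] (∸-monoʳ-≤ e₁ (<⇒≤pred j<)) ,
        subst (e₁ ∸ j <_) e₁∸p₀ (∸-monoʳ-< p≤j (bounded w))

      neighbours : ∀ {w} → (Window ∖ ｛ spine e₂ ｝) w → spine e₂ ~ w ⇔ spine e₁ ≡ w
      neighbours {spine i} (i<m , _) = mk⇔
        [ (λ e₂<i → contradiction i<m (≤⇒≯ (subst (_≤ i) (sym m≡) (≤-reflexive e₂<i))))
        , (λ i+1≡e₂ → cong spine (sym (suc-injective i+1≡e₂))) ]
        (λ { refl → inj₂ refl })
      neighbours {tooth j} ((_ , j<) , _) = mk⇔
        [ (λ { refl → contradiction (≤-trans j< p+q≤e₁) (≤⇒≯ (n≤1+n e₁)) }) , (λ ()) ]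
        λ ()

  LastSpineEdge : (G : Graph) → Fin (size G) → Fin (size G) → Set
  LastSpineEdge G x y = ∃[ π ] Induced G Window π × π (spine e₁) ≡ x × π (spine e₂) ≡ y

  module _ {G : Graph} (no-simplicial : ¬ Σ (Copy (T₃ p q) G) Simplicial) where

    ¬¬extension : ∀ {π} (g : Induced G Window π) → ¬ ¬ HasExtension (T₃-copy g)
    ¬¬extension g ¬ext = no-simplicial (T₃-copy g , ¬ext)

    advance : ∀ {π} → Induced G Window π →
              ¬ ¬ (∃[ π′ ] Induced G Window π′ ×
                           π′ (spine e₀) ≡ π (spine e₁) × π′ (spine e₁) ≡ π (spine e₂))
    advance {π} g k = ¬¬extension g λ ext →
      let t  = Extension.t′ ext
          πᵗ = update (π ∘ reflect e₂) (tooth p) t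
          gᵗ = reattach-tooth g (pendant₂ g ext)
      in ¬¬extension gᵗ λ ext′ →
      let s  = Extension.s′ ext′
          π′ = update (πᵗ ∘ reflect e₁) (spine e₂) s
          open ≡-Reasoning
          -- on the spine, reflect e₂ ∘ reflect e₁ is i ↦ i + 1
          shift₀ : π′ (spine e₀) ≡ π (spine e₁)
          shift₀ = begin
            π′ (spine e₀)        ≡⟨ update-other (πᵗ ∘ reflect e₁) (spine e₂) s
                                      (<⇒≢ e₀<e₂ ∘ sym ∘ spine-injective) ⟩
            πᵗ (spine (e₁ ∸ e₀)) ≡⟨ cong (πᵗ ∘ spine) (m+n∸n≡m 1 e₀) ⟩
            πᵗ (spine 1)         ≡⟨ update-other (π ∘ reflect e₂) (tooth p) t {spine 1} (λ ()) ⟩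
            π (spine e₁)         ∎
          shift₁ : π′ (spine e₁) ≡ π (spine e₂)
          shift₁ = begin
            π′ (spine e₁)        ≡⟨ update-other (πᵗ ∘ reflect e₁) (spine e₂) s
                                      (1+n≢n ∘ spine-injective) ⟩
            πᵗ (spine (e₁ ∸ e₁)) ≡⟨ cong (πᵗ ∘ spine) (n∸n≡0 e₁) ⟩
            πᵗ (spine 0)         ≡⟨ update-other (π ∘ reflect e₂) (tooth p) t {spine 0} (λ ()) ⟩
            π (spine e₂)         ∎
      in k (π′ , reattach-spine gᵗ (pendant₁ gᵗ ext′) , shift₀ , shift₁)

    uniqueLowerNeighbour⇒¬Induced : ∀ {π} → UniqueLowerNeighbour G → ¬ Induced G Window π
    uniqueLowerNeighbour⇒¬Induced {π} unique g =
      no-endless-walk G unique (LastSpineEdge G) spine-adjacent continues (π , g , refl , refl)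
      where
      spine-adjacent : ∀ {x y} → LastSpineEdge G x y → adj G x y ≡ true
      spine-adjacent (_ , g , refl , refl) = from (adjacent g e₁<m e₂<m) (inj₁ refl)

      continues : ∀ {x y} → LastSpineEdge G x y → ¬ ¬ (∃[ z ] LastSpineEdge G y z × x ≢ z)
      continues (_ , g , refl , refl) k = advance g λ (π′ , g′ , e₀↦e₁ , e₁↦e₂) →
        k (π′ (spine e₂) , (π′ , g′ , e₁↦e₂ , refl) ,
           <⇒≢ e₀<e₂ ∘ spine-injective ∘ injective g′ e₀<m e₂<m ∘ trans e₀↦e₁)

  no-finite-PE-sequence : ∀ {G π} → UniqueLowerNeighbour G → Induced G Window π →
                          ¬ FinitePESeqFrom (T₃ p q) G
  no-finite-PE-sequence unique g (stop no-simplicial) = uniqueLowerNeighbour⇒¬Induced no-simplicial unique g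
  no-finite-PE-sequence unique g (step _ _ l _ rest)  =
    no-finite-PE-sequence (UniqueLowerNeighbour-addPendants _ l unique) (Induced-↑ˡ _ l g) rest

proposition3p35 : (p q : ℕ) → 1 ≤ p → PEInherent (T₃ p q)
proposition3p35 zero     q ()
proposition3p35 (suc p₀) q _  = no-finite-PE-sequence T₃-uniqueLowerNeighbour π₀-induced
  where open T₃-Comb p₀ q
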